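{- Let $G$ be a graph with $m$ edges and $n$ vertices. There exists a vertex $x$ of $G$ such that the subgraph of $G$ induced by the vertices at graph distance at most two from $x$ has at least $\frac{m^2}{8n^2}$ edges.
   Context: Graphs are finite, simple and loopless. -}

module Defs where

open import Data.Nat using (ℕ; zero; suc; _+_; _*_; _≤_)
open import Data.Fin using (Fin; toℕ)
open import Data.Fin.Properties using (_<?_)
open import Data.Bool using (Bool; true; false; _∧_; _∨_; if_then_else_)
open import Data.List using (List; sum; map; allFin; concatMap; filter; length)
open import Relation.Binary.PropositionalEquality using (_≡_)
open import Relation.Nullary.Decidable using (⌊_⌋)

record Graph (n : ℕ) : Set where
  field
    adj     : Fin n → Fin n → Bool
    sym     : ∀ u v → adj u v ≡ adj v u
    irrefl  : ∀ v → adj v v ≡ false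
open Graph public

anyFin : (n : ℕ) → (Fin n → Bool) → Bool
anyFin n p = Data.List.foldr _∨_ false (map p (allFin n))
  where import Data.List

countPairs : (n : ℕ) → (Fin n → Fin n → Bool) → ℕ
countPairs n p =
  length (filter (λ ij → p (proj₁ ij) (proj₂ ij) Data.Bool.≟ true)
    (concatMap (λ i → map (λ j → (i , j))
                 (filter (λ j → toℕ i Data.Nat.<? toℕ j) (allFin n)))
               (allFin n)))
  where
    open import Data.Product using (proj₁; proj₂; _,_)
    import Data.Bool
    import Data.Nat

edges : ∀ {n} → Graph n → ℕ
edges {n} G = countPairs n (adj G)

dist≤2 : ∀ {n} → Graph n → Fin n → Fin n → Bool
dist≤2 {n} G x v =
  ⌊ x Data.Fin.≟ v ⌋ ∨ adj G x v ∨ anyFin n (λ w → adj G x w ∧ adj G w v)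
  where import Data.Fin

ballEdges : ∀ {n} → Graph n → Fin n → ℕ
ballEdges {n} G x =
  countPairs n (λ u v → dist≤2 G x u ∧ dist≤2 G x v ∧ adj G u v)

-- Write d(u) for the degree of u, so that Σ d(u) = 2m. Summing Σ_{u ~ x} d(u)
-- over all x counts each d(u) exactly d(u) times, so the total is
-- Σ d(u)² ≥ (2m)²/n by Cauchy–Schwarz, and some x has Σ_{u ~ x} d(u) ≥ 4m²/n².
-- Every edge at a neighbour of x lies in the ball of radius two around x, and
-- each edge of the ball is counted at most twice in that sum, so the ball has
-- at least 2m²/n² ≥ m²/(8n²) edges.
module Submission where

open import Defs
open import Data.Nat.Properties
open import Algebra.Properties.Semiring.Sum +-*-semiring
  using (sum; sum-syntax; sum-cong-≗; ∑-distrib-+; ∑-comm; *-distribˡ-sum; *-distribʳ-sum)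
open import Data.Bool as Bool using (Bool; true; false; _∧_; T)
open import Data.Bool.Properties using (∧-assoc; ∧-comm; ∧-zeroʳ; T-∧; T-∨)
open import Data.Fin as Fin using (Fin; zero; suc; toℕ)
open import Data.Fin.Properties using (toℕ-injective)
open import Data.List using (List; []; _∷_; _++_; map; filter; concatMap; length; tabulate; allFin)
open import Data.List.Properties using (map-++; map-∘)
open import Data.List.Relation.Unary.Any.Properties using (any⁺; tabulate⁺)
open import Data.Nat using (ℕ; zero; suc; _+_; _*_; _≤_; _<?_; z≤n)
open import Data.Nat.ListAction using () renaming (sum to sumᴸ)
open import Data.Nat.ListAction.Properties using (sum-++)
open import Data.Nat.Tactic.RingSolver using (solve-∀)
open import Data.Product using (∃; _,_; _×_; proj₁; proj₂)
open import Data.Sum using (inj₁; inj₂; [_,_]′)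
open import Function using (_∘_; Equivalence)
open import Level using (0ℓ)
open import Relation.Binary.Definitions using (tri<; tri≈; tri>)
open import Relation.Binary.PropositionalEquality as ≡
  using (_≡_; refl; cong; cong₂; trans; module ≡-Reasoning)
open import Relation.Nullary using (does)
open import Relation.Nullary.Decidable using (⌊_⌋; dec-true; dec-false)
open import Relation.Unary using (Pred; Decidable)

open Equivalence using (to; from)

𝟙 : Bool → ℕ
𝟙 true  = 1
𝟙 false = 0

𝟙-∧ : ∀ b c → 𝟙 (b ∧ c) ≡ 𝟙 b * 𝟙 c
𝟙-∧ true  c = ≡.sym (+-identityʳ (𝟙 c))
𝟙-∧ false c = refl

𝟙-mono : ∀ {b c} → (T b → T c) → 𝟙 b ≤ 𝟙 c
𝟙-mono {false}         _   = z≤n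
𝟙-mono {true}  {true}  _   = ≤-refl
𝟙-mono {true}  {false} b⇒c with () ← b⇒c _

does-≟-true : ∀ b → does (b Bool.≟ true) ≡ b
does-≟-true true  = refl
does-≟-true false = refl

module _ {A : Set} where

  length-filter : {P : Pred A 0ℓ} (P? : Decidable P) (xs : List A) →
    length (filter P? xs) ≡ sumᴸ (map (𝟙 ∘ does ∘ P?) xs)
  length-filter P? []       = refl
  length-filter P? (x ∷ xs) with does (P? x)
  ... | true  = cong suc (length-filter P? xs)
  ... | false = length-filter P? xs

  sum-map-filter : {P : Pred A 0ℓ} (P? : Decidable P) (f : A → ℕ) (xs : List A) →
    sumᴸ (map f (filter P? xs)) ≡ sumᴸ (map (λ x → 𝟙 (does (P? x)) * f x) xs)
  sum-map-filter P? f []       = refl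
  sum-map-filter P? f (x ∷ xs) with does (P? x)
  ... | true  = cong₂ _+_ (≡.sym (+-identityʳ (f x))) (sum-map-filter P? f xs)
  ... | false = sum-map-filter P? f xs

  sum-map-concatMap : {B : Set} (f : B → ℕ) (g : A → List B) (xs : List A) →
    sumᴸ (map f (concatMap g xs)) ≡ sumᴸ (map (λ x → sumᴸ (map f (g x))) xs)
  sum-map-concatMap f g []       = refl
  sum-map-concatMap f g (x ∷ xs) = begin
    sumᴸ (map f (g x ++ concatMap g xs))
      ≡⟨ cong sumᴸ (map-++ f (g x) (concatMap g xs)) ⟩
    sumᴸ (map f (g x) ++ map f (concatMap g xs))
      ≡⟨ sum-++ (map f (g x)) (map f (concatMap g xs)) ⟩
    sumᴸ (map f (g x)) + sumᴸ (map f (concatMap g xs))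
      ≡⟨ cong (sumᴸ (map f (g x)) +_) (sum-map-concatMap f g xs) ⟩
    sumᴸ (map f (g x)) + sumᴸ (map (λ x → sumᴸ (map f (g x))) xs)
      ∎
    where open ≡-Reasoning

sum-map-tabulate : ∀ {n} {A : Set} (f : A → ℕ) (g : Fin n → A) →
  sumᴸ (map f (tabulate g)) ≡ ∑[ i < n ] f (g i)
sum-map-tabulate {zero}  f g = refl
sum-map-tabulate {suc n} f g = cong (f (g zero) +_) (sum-map-tabulate f (g ∘ suc))

∑-mono-≤ : ∀ {n} {f g : Fin n → ℕ} → (∀ i → f i ≤ g i) → sum f ≤ sum g
∑-mono-≤ {zero}  f≤g = z≤n
∑-mono-≤ {suc n} f≤g = +-mono-≤ (f≤g zero) (∑-mono-≤ (f≤g ∘ suc))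

∑-const : ∀ n c → ∑[ i < n ] c ≡ n * c
∑-const zero    c = refl
∑-const (suc n) c = cong (c +_) (∑-const n c)

∑-*-∑ : ∀ {m n} (f : Fin m → ℕ) (g : Fin n → ℕ) →
  sum f * sum g ≡ ∑[ i < m ] ∑[ j < n ] (f i * g j)
∑-*-∑ f g = trans (*-distribʳ-sum (sum g) f) (sum-cong-≗ λ i → *-distribˡ-sum (f i) g)

∃[i]sum≤n*f[i] : ∀ {n} (f : Fin (suc n) → ℕ) → ∃ λ i → sum f ≤ suc n * f i
∃[i]sum≤n*f[i] {zero}  f = zero , ≤-refl
∃[i]sum≤n*f[i] {suc n} f with i , sum≤n*fi ← ∃[i]sum≤n*f[i] (f ∘ suc)
                            with ≤-total (f zero) (f (suc i))
... | inj₁ f0≤fi = suc i , +-mono-≤ f0≤fi sum≤n*fi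
... | inj₂ fi≤f0 = zero , +-monoʳ-≤ (f zero) (≤-trans sum≤n*fi (*-monoʳ-≤ (suc n) fi≤f0))

2*[m*n]≤m*m+n*n : ∀ m n → 2 * (m * n) ≤ m * m + n * n
2*[m*n]≤m*m+n*n m n = [ ≤-case , ≥-case ]′ (≤-total m n)
  where
  ≤-case : ∀ {m n} → m ≤ n → 2 * (m * n) ≤ m * m + n * n
  ≤-case {m} m≤n with k , refl ← m≤n⇒∃[o]m+o≡n m≤n = begin
    2 * (m * (m + k))          ≤⟨ m≤m+n (2 * (m * (m + k))) (k * k) ⟩
    2 * (m * (m + k)) + k * k  ≡⟨ square-expansion m k ⟩
    m * m + (m + k) * (m + k)  ∎
    where
    open ≤-Reasoning
    square-expansion : ∀ m k → 2 * (m * (m + k)) + k * k ≡ m * m + (m + k) * (m + k)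
    square-expansion = solve-∀

  ≥-case : n ≤ m → 2 * (m * n) ≤ m * m + n * n
  ≥-case n≤m = ≡.subst₂ _≤_ (cong (2 *_) (*-comm n m)) (+-comm (n * n) (m * m)) (≤-case n≤m)

sum*sum≤n*sum-squares : ∀ {n} (f : Fin n → ℕ) → sum f * sum f ≤ n * ∑[ i < n ] (f i * f i)
sum*sum≤n*sum-squares {n} f = *-cancelˡ-≤ 2 (begin
  2 * (sum f * sum f)
    ≡⟨ cong (2 *_) (∑-*-∑ f f) ⟩
  2 * ∑[ i < n ] ∑[ j < n ] (f i * f j)
    ≡⟨ trans (*-distribˡ-sum 2 (λ i → ∑[ j < n ] (f i * f j)))
             (sum-cong-≗ λ i → *-distribˡ-sum 2 (λ j → f i * f j)) ⟩
  ∑[ i < n ] ∑[ j < n ] (2 * (f i * f j))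
    ≤⟨ ∑-mono-≤ (λ i → ∑-mono-≤ λ j → 2*[m*n]≤m*m+n*n (f i) (f j)) ⟩
  ∑[ i < n ] ∑[ j < n ] (f i * f i + f j * f j)
    ≡⟨ sum-cong-≗ (λ i → ∑-distrib-+ (λ _ → f i * f i) (λ j → f j * f j)) ⟩
  ∑[ i < n ] (∑[ j < n ] (f i * f i) + Q)
    ≡⟨ ∑-distrib-+ (λ i → ∑[ j < n ] (f i * f i)) (λ _ → Q) ⟩
  ∑[ i < n ] ∑[ j < n ] (f i * f i) + ∑[ i < n ] Q
    ≡⟨ cong₂ _+_ (trans (sum-cong-≗ λ i → ∑-const n (f i * f i)) (≡.sym (*-distribˡ-sum n (λ i → f i * f i))))
                 (∑-const n Q) ⟩
  n * Q + n * Q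
    ≡⟨ cong (n * Q +_) (+-identityʳ (n * Q)) ⟨
  2 * (n * Q)
    ∎)
  where
  open ≤-Reasoning
  Q = ∑[ i < n ] (f i * f i)

_≺_ : ∀ {n} → Fin n → Fin n → Bool
i ≺ j = does (toℕ i <? toℕ j)

countPairs≡∑∑ : ∀ n (p : Fin n → Fin n → Bool) →
  countPairs n p ≡ ∑[ i < n ] ∑[ j < n ] (𝟙 (i ≺ j) * 𝟙 (p i j))
countPairs≡∑∑ n p = begin
  length (filter P? (concatMap pairs (allFin n)))      ≡⟨ length-filter P? (concatMap pairs (allFin n)) ⟩
  sumᴸ (map h (concatMap pairs (allFin n)))            ≡⟨ sum-map-concatMap h pairs (allFin n) ⟩
  sumᴸ (map (λ i → sumᴸ (map h (pairs i))) (allFin n)) ≡⟨ sum-map-tabulate {n} _ (λ i → i) ⟩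
  ∑[ i < n ] sumᴸ (map h (pairs i))                    ≡⟨ sum-cong-≗ row ⟩
  ∑[ i < n ] ∑[ j < n ] (𝟙 (i ≺ j) * 𝟙 (p i j))        ∎
  where
  open ≡-Reasoning
  P? : Decidable (λ (ij : Fin n × Fin n) → p (proj₁ ij) (proj₂ ij) ≡ true)
  P? ij = p (proj₁ ij) (proj₂ ij) Bool.≟ true
  h : Fin n × Fin n → ℕ
  h = 𝟙 ∘ does ∘ P?
  later : Fin n → List (Fin n)
  later i = filter (λ j → toℕ i <? toℕ j) (allFin n)
  pairs : Fin n → List (Fin n × Fin n)
  pairs i = map (i ,_) (later i)
  row : ∀ i → sumᴸ (map h (pairs i)) ≡ ∑[ j < n ] (𝟙 (i ≺ j) * 𝟙 (p i j))
  row i = begin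
    sumᴸ (map h (map (i ,_) (later i)))                 ≡⟨ cong sumᴸ (map-∘ (later i)) ⟨
    sumᴸ (map (h ∘ (i ,_)) (later i))                   ≡⟨ sum-map-filter (λ j → toℕ i <? toℕ j) (h ∘ (i ,_)) (allFin n) ⟩
    sumᴸ (map (λ j → 𝟙 (i ≺ j) * h (i , j)) (allFin n)) ≡⟨ sum-map-tabulate {n} _ (λ j → j) ⟩
    ∑[ j < n ] (𝟙 (i ≺ j) * h (i , j))
      ≡⟨ sum-cong-≗ (λ j → cong (λ b → 𝟙 (i ≺ j) * 𝟙 b) (does-≟-true (p i j))) ⟩
    ∑[ j < n ] (𝟙 (i ≺ j) * 𝟙 (p i j))                  ∎

𝟙-split : ∀ {n} (p : Fin n → Fin n → Bool) → (∀ v → p v v ≡ false) → ∀ i j →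
  𝟙 (p i j) ≡ (𝟙 (i ≺ j) + 𝟙 (j ≺ i)) * 𝟙 (p i j)
𝟙-split p irrefl-p i j with <-cmp (toℕ i) (toℕ j)
... | tri< i<j _ j≮i = ≡.sym (trans
  (cong₂ (λ a b → (𝟙 a + 𝟙 b) * 𝟙 (p i j)) (dec-true (toℕ i <? toℕ j) i<j) (dec-false (toℕ j <? toℕ i) j≮i))
  (+-identityʳ (𝟙 (p i j))))
... | tri> i≮j _ j<i = ≡.sym (trans
  (cong₂ (λ a b → (𝟙 a + 𝟙 b) * 𝟙 (p i j)) (dec-false (toℕ i <? toℕ j) i≮j) (dec-true (toℕ j <? toℕ i) j<i))
  (+-identityʳ (𝟙 (p i j))))
... | tri≈ _ i≡j _ with refl ← toℕ-injective i≡j rewrite irrefl-p i = ≡.sym (*-zeroʳ (𝟙 (i ≺ i) + 𝟙 (i ≺ i)))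

∑∑𝟙≡2*countPairs : ∀ {n} (p : Fin n → Fin n → Bool) →
  (∀ u v → p u v ≡ p v u) → (∀ v → p v v ≡ false) →
  ∑[ i < n ] ∑[ j < n ] 𝟙 (p i j) ≡ 2 * countPairs n p
∑∑𝟙≡2*countPairs {n} p sym-p irrefl-p = begin
  ∑[ i < n ] ∑[ j < n ] 𝟙 (p i j)
    ≡⟨ sum-cong-≗ (λ i → trans (sum-cong-≗ λ j → trans (𝟙-split p irrefl-p i j) (*-distribʳ-+ (𝟙 (p i j)) (𝟙 (i ≺ j)) (𝟙 (j ≺ i))))
                             (∑-distrib-+ (below i) (above i))) ⟩
  ∑[ i < n ] (sum (below i) + sum (above i))
    ≡⟨ ∑-distrib-+ (sum ∘ below) (sum ∘ above) ⟩
  ∑[ i < n ] sum (below i) + ∑[ i < n ] sum (above i)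
    ≡⟨ cong (∑[ i < n ] sum (below i) +_) (trans (∑-comm above) (sum-cong-≗ λ j → sum-cong-≗ λ i →
         cong (λ b → 𝟙 (j ≺ i) * 𝟙 b) (sym-p i j))) ⟩
  ∑[ i < n ] sum (below i) + ∑[ i < n ] sum (below i)
    ≡⟨ cong (∑[ i < n ] sum (below i) +_) (+-identityʳ _) ⟨
  2 * ∑[ i < n ] sum (below i)
    ≡⟨ cong (2 *_) (countPairs≡∑∑ n p) ⟨
  2 * countPairs n p
    ∎
  where
  open ≡-Reasoning
  below above : Fin n → Fin n → ℕ
  below i j = 𝟙 (i ≺ j) * 𝟙 (p i j)
  above i j = 𝟙 (j ≺ i) * 𝟙 (p i j)

module _ {n : ℕ} (G : Graph n) where

  degree : Fin n → ℕ
  degree v = ∑[ w < n ] 𝟙 (adj G v w)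

  sum-degree≡2*edges : sum degree ≡ 2 * edges G
  sum-degree≡2*edges = ∑∑𝟙≡2*countPairs (adj G) (sym G) (irrefl G)

  neighbourDegreeSum : Fin n → ℕ
  neighbourDegreeSum x = ∑[ u < n ] (𝟙 (adj G x u) * degree u)

  sum-neighbourDegreeSum≡sum-degree² :
    sum neighbourDegreeSum ≡ ∑[ u < n ] (degree u * degree u)
  sum-neighbourDegreeSum≡sum-degree² =
    trans (∑-comm (λ x u → 𝟙 (adj G x u) * degree u)) (sum-cong-≗ λ u → begin
      ∑[ x < n ] (𝟙 (adj G x u) * degree u)  ≡⟨ sum-cong-≗ (λ x → cong (λ b → 𝟙 b * degree u) (sym G x u)) ⟩
      ∑[ x < n ] (𝟙 (adj G u x) * degree u)  ≡⟨ *-distribʳ-sum (degree u) (𝟙 ∘ adj G u) ⟨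
      degree u * degree u                    ∎)
    where open ≡-Reasoning

  ballAdj : Fin n → Fin n → Fin n → Bool
  ballAdj x u v = dist≤2 G x u ∧ dist≤2 G x v ∧ adj G u v

  ballAdj-sym : ∀ x u v → ballAdj x u v ≡ ballAdj x v u
  ballAdj-sym x u v = begin
    du ∧ dv ∧ adj G u v    ≡⟨ ∧-assoc du dv (adj G u v) ⟨
    (du ∧ dv) ∧ adj G u v  ≡⟨ cong₂ _∧_ (∧-comm du dv) (sym G u v) ⟩
    (dv ∧ du) ∧ adj G v u  ≡⟨ ∧-assoc dv du (adj G v u) ⟩
    dv ∧ du ∧ adj G v u    ∎
    where
    open ≡-Reasoning
    du = dist≤2 G x u
    dv = dist≤2 G x v

  ballAdj-irrefl : ∀ x v → ballAdj x v v ≡ false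
  ballAdj-irrefl x v rewrite irrefl G v =
    trans (cong (dist≤2 G x v ∧_) (∧-zeroʳ (dist≤2 G x v))) (∧-zeroʳ (dist≤2 G x v))

  ballAdj-of-path : ∀ x u v → T (adj G x u ∧ adj G u v) → T (ballAdj x u v)
  ballAdj-of-path x u v xuv with x~u , u~v ← to T-∧ xuv =
    from T-∧ (u-near , from T-∧ (v-near , u~v))
    where
    u-near : T (dist≤2 G x u)
    u-near = from (T-∨ {⌊ x Fin.≟ u ⌋}) (inj₂ (from (T-∨ {adj G x u}) (inj₁ x~u)))
    v-near : T (dist≤2 G x v)
    v-near = from (T-∨ {⌊ x Fin.≟ v ⌋}) (inj₂ (from (T-∨ {adj G x v}) (inj₂ (any⁺ _ (tabulate⁺ u xuv)))))

  neighbourDegreeSum≤2*ballEdges : ∀ x → neighbourDegreeSum x ≤ 2 * ballEdges G x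
  neighbourDegreeSum≤2*ballEdges x = begin
    ∑[ u < n ] (𝟙 (adj G x u) * degree u)
      ≡⟨ sum-cong-≗ (λ u → *-distribˡ-sum (𝟙 (adj G x u)) (𝟙 ∘ adj G u)) ⟩
    ∑[ u < n ] ∑[ v < n ] (𝟙 (adj G x u) * 𝟙 (adj G u v))
      ≡⟨ sum-cong-≗ (λ u → sum-cong-≗ λ v → 𝟙-∧ (adj G x u) (adj G u v)) ⟨
    ∑[ u < n ] ∑[ v < n ] 𝟙 (adj G x u ∧ adj G u v)
      ≤⟨ ∑-mono-≤ (λ u → ∑-mono-≤ λ v → 𝟙-mono (ballAdj-of-path x u v)) ⟩
    ∑[ u < n ] ∑[ v < n ] 𝟙 (ballAdj x u v)
      ≡⟨ ∑∑𝟙≡2*countPairs (ballAdj x) (ballAdj-sym x) (ballAdj-irrefl x) ⟩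
    2 * ballEdges G x
      ∎
    where open ≤-Reasoning

lemma3 : (n : ℕ) → 1 ≤ n → (G : Graph n) →
    ∃ λ (x : Fin n) →
      edges G * edges G ≤ 8 * (n * n) * ballEdges G x
lemma3 n@(suc _) _ G with x , sum≤n*nds[x] ← ∃[i]sum≤n*f[i] (neighbourDegreeSum G) =
  x , (begin
    m * m                                    ≤⟨ m≤n*m (m * m) 4 ⟩
    4 * (m * m)                              ≡⟨ four-squares m ⟩
    2 * m * (2 * m)                          ≡⟨ cong₂ _*_ (sum-degree≡2*edges G) (sum-degree≡2*edges G) ⟨
    sum (degree G) * sum (degree G)          ≤⟨ sum*sum≤n*sum-squares (degree G) ⟩
    n * ∑[ u < n ] (degree G u * degree G u) ≡⟨ cong (n *_) (sum-neighbourDegreeSum≡sum-degree² G) ⟨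
    n * sum (neighbourDegreeSum G)           ≤⟨ *-monoʳ-≤ n sum≤n*nds[x] ⟩
    n * (n * neighbourDegreeSum G x)         ≤⟨ *-monoʳ-≤ n (*-monoʳ-≤ n (neighbourDegreeSum≤2*ballEdges G x)) ⟩
    n * (n * (2 * ballEdges G x))            ≤⟨ m≤n*m _ 4 ⟩
    4 * (n * (n * (2 * ballEdges G x)))      ≡⟨ eight-n² n (ballEdges G x) ⟩
    8 * (n * n) * ballEdges G x              ∎)
  where
  open ≤-Reasoning
  m = edges G
  four-squares : ∀ m → 4 * (m * m) ≡ 2 * m * (2 * m)
  four-squares = solve-∀
  eight-n² : ∀ n b → 4 * (n * (n * (2 * b))) ≡ 8 * (n * n) * b
  eight-n² = solve-∀
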